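{- Let $n,k\ge1$ and $m\ge 2$ be integers, and let $P\in\mathcal{P}(n,k,m)$ be noncrossing. Let $R(P)$ be the partition of $[n-1]$ produced by the reduction algorithm: replace every arc $(i,j)$ of the linear representation $D(P)$ by the arc $(i,j-1)$, delete the vertex $n$, and take the blocks to be the vertex sets of the connected components of the resulting digraph on $[n-1]$. Then $R(P)$ is a noncrossing partition of $[n-1]$.
   Context: A partition of $[n]=\{1,\dots,n\}$ is a set of nonempty pairwise disjoint subsets (blocks) whose union is $[n]$. A partition is $m$-regular if any two distinct elements $x,y$ in the same block satisfy $|x-y|\ge m$; $\mathcal{P}(n,k,m)$ denotes the set of $m$-regular partitions of $[n]$ with $k$ blocks. A partition is noncrossing ($abab$-free) if there do not exist $x<u<y<v$ in $[n]$ with $x,y$ in one block and $u,v$ in a different block. The linear representation $D(P)$ is the digraph on $[n]$ which, for each block $\{b_1<\dots<b_r\}$, contains the arcs $(b_1,b_2),\dots,(b_{r-1},b_r)$. -}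

module Defs where

open import Data.Nat using (ℕ; zero; suc; _≤_; _<_; _∸_)
open import Data.Fin using (Fin; toℕ)
open import Data.Product using (Σ; ∃; _×_; _,_)
open import Relation.Nullary using (¬_)
open import Relation.Binary.PropositionalEquality using (_≡_; _≢_)
open import Relation.Binary.Construct.Closure.Equivalence using (EqClosure)

-- Convention: the ground set [n] = {1,…,n} is represented by Fin n, the
-- element i ∈ [n] being the Fin-index with toℕ = i - 1 (order and
-- differences are preserved).

absDiff : ℕ → ℕ → ℕ
absDiff a b = (a ∸ b) Data.Nat.+ (b ∸ a)

-- A partition of [n] with k blocks is given by a surjective block-labelling
-- P : Fin n → Fin k (blocks = nonempty fibres; surjective ⇔ exactly k blocks).
Surj : {n k : ℕ} → (Fin n → Fin k) → Set
Surj {n} {k} P = (b : Fin k) → ∃ λ (a : Fin n) → P a ≡ b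

SameBlock : {n k : ℕ} → (Fin n → Fin k) → Fin n → Fin n → Set
SameBlock P x y = P x ≡ P y

Regular : {n k : ℕ} → ℕ → (Fin n → Fin k) → Set
Regular {n} m P = (x y : Fin n) → x ≢ y → P x ≡ P y → m ≤ absDiff (toℕ x) (toℕ y)

NoncrossingRel : {n : ℕ} → (Fin n → Fin n → Set) → Set
NoncrossingRel {n} _~_ =
  (x u y v : Fin n) → toℕ x < toℕ u → toℕ u < toℕ y → toℕ y < toℕ v →
  ¬ (x ~ y × u ~ v × ¬ (x ~ u))

Noncrossing : {n k : ℕ} → (Fin n → Fin k) → Set
Noncrossing P = NoncrossingRel (SameBlock P)

Arc : {n k : ℕ} → (Fin n → Fin k) → Fin n → Fin n → Set
Arc {n} P i j =
  toℕ i < toℕ j × P i ≡ P j ×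
  ((l : Fin n) → toℕ i < toℕ l → toℕ l < toℕ j → P l ≢ P i)

ReducedArc : {n' k : ℕ} → (Fin (suc n') → Fin k) → Fin n' → Fin n' → Set
ReducedArc {n'} P a b =
  Σ (Fin (suc n')) λ i → Σ (Fin (suc n')) λ j →
    Arc P i j × toℕ i ≡ toℕ a × toℕ j ≡ suc (toℕ b)

-- R(P): blocks are the vertex sets of the connected components of the
-- reduced digraph, i.e. the same-block relation is the equivalence
-- closure (reflexive–symmetric–transitive) of the reduced arc relation.
RBlock : {n' k : ℕ} → (Fin (suc n') → Fin k) → Fin n' → Fin n' → Set
RBlock P = EqClosure (ReducedArc P)

-- Since P is 2-regular, every arc (i , j) of D(P) has j ≥ i + 2, so its reduced arc
-- (i , j - 1) still goes upwards. Two reduced arcs (a , b) and (c , d) with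
-- a < c ≤ b < d come from the arcs (a , b + 1) and (c , d + 1) of D(P), which cross
-- because c lies strictly inside the first one; so no such pair exists. With c = b
-- this says that no two reduced arcs are consecutive, and as D(P), hence the reduced
-- digraph, has in- and out-degrees at most one, every connected component of the
-- reduced digraph is a single vertex or a single arc. A crossing x < u < y < v in
-- R(P) therefore consists of two reduced arcs (x , y) and (u , v), which is the
-- excluded configuration.
module Submission where

open import Defs
open import Data.Nat using (ℕ; suc; _+_; _∸_; _≤_; _<_; s≤s)
open import Data.Nat.Properties
open import Data.Fin using (Fin; toℕ)
open import Data.Fin.Properties using (toℕ-injective)
open import Data.Product using (_,_)
open import Data.Empty using (⊥; ⊥-elim)
open import Relation.Binary using (tri<; tri≈; tri>)
open import Relation.Binary.PropositionalEquality
open import Relation.Binary.Construct.Closure.Reflexive using (ReflClosure; refl; [_])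
open import Relation.Binary.Construct.Closure.Symmetric using (SymClosure; fwd; bwd)
open import Relation.Binary.Construct.Closure.ReflexiveTransitive using (ε; _◅_)

absDiff-≤ : ∀ {p q} → p ≤ q → absDiff p q ≡ q ∸ p
absDiff-≤ {p} {q} p≤q = cong (_+ (q ∸ p)) (m≤n⇒m∸n≡0 p≤q)

module _ {n k : ℕ} {P : Fin n → Fin k} where

  arc-target-unique : ∀ {i j j′} → Arc P i j → Arc P i j′ → j ≡ j′
  arc-target-unique {j = j} {j′} (i<j , e , gap) (i<j′ , e′ , gap′) with <-cmp (toℕ j) (toℕ j′)
  ... | tri< j<j′ _ _ = ⊥-elim (gap′ j i<j j<j′ (sym e))
  ... | tri≈ _ j≡j′ _ = toℕ-injective j≡j′
  ... | tri> _ _ j′<j = ⊥-elim (gap j′ i<j′ j′<j (sym e′))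

  arc-source-unique : ∀ {i i′ j} → Arc P i j → Arc P i′ j → i ≡ i′
  arc-source-unique {i} {i′} (i<j , e , gap) (i′<j , e′ , gap′) with <-cmp (toℕ i) (toℕ i′)
  ... | tri< i<i′ _ _ = ⊥-elim (gap i′ i<i′ i′<j (trans e′ (sym e)))
  ... | tri≈ _ i≡i′ _ = toℕ-injective i≡i′
  ... | tri> _ _ i′<i = ⊥-elim (gap′ i i′<i i<j (trans e (sym e′)))

  regular⇒arc-length : ∀ {m i j} → Regular m P → Arc P i j → m + toℕ i ≤ toℕ j
  regular⇒arc-length {m} {i} {j} reg (i<j , e , _) =
    m≤o∸n⇒m+n≤o m (<⇒≤ i<j) (subst (m ≤_) (absDiff-≤ (<⇒≤ i<j)) (reg i j i≢j e))
    where
    i≢j : i ≢ j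
    i≢j refl = <-irrefl refl i<j

  arcs-noncrossing : ∀ {i i′ j j′} → Noncrossing P → Arc P i j → Arc P i′ j′ →
                     toℕ i < toℕ i′ → toℕ i′ < toℕ j → toℕ j < toℕ j′ → ⊥
  arcs-noncrossing {i} {i′} {j} {j′} nc (_ , e , gap) (_ , e′ , _) i<i′ i′<j j<j′ =
    nc i i′ j j′ i<i′ i′<j j<j′ (e , e′ , λ e″ → gap i′ i<i′ i′<j (sym e″))

module _ {n′ k : ℕ} {P : Fin (suc n′) → Fin k} where

  reducedArc-target-unique : ∀ {a b b′} → ReducedArc P a b → ReducedArc P a b′ → b ≡ b′
  reducedArc-target-unique {b = b} {b′} (i , j , arc , ia , jb) (i′ , j′ , arc′ , i′a , j′b′)
    with toℕ-injective (trans ia (sym i′a))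
  ... | refl = toℕ-injective (suc-injective (begin
    suc (toℕ b)  ≡⟨ sym jb ⟩
    toℕ j        ≡⟨ cong toℕ (arc-target-unique arc arc′) ⟩
    toℕ j′       ≡⟨ j′b′ ⟩
    suc (toℕ b′) ∎))
    where open ≡-Reasoning

  reducedArc-source-unique : ∀ {a a′ b} → ReducedArc P a b → ReducedArc P a′ b → a ≡ a′
  reducedArc-source-unique {a} {a′} (i , j , arc , ia , jb) (i′ , j′ , arc′ , i′a′ , j′b)
    with toℕ-injective (trans jb (sym j′b))
  ... | refl = toℕ-injective (begin
    toℕ a   ≡⟨ sym ia ⟩
    toℕ i   ≡⟨ cong toℕ (arc-source-unique arc arc′) ⟩
    toℕ i′  ≡⟨ i′a′ ⟩
    toℕ a′  ∎)
    where open ≡-Reasoning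

  reducedArc-increasing : ∀ {m a b} → 2 ≤ m → Regular m P → ReducedArc P a b → toℕ a < toℕ b
  reducedArc-increasing 2≤m reg (i , j , arc , ia , jb) =
    ≤-pred (subst₂ _≤_ (cong (2 +_) ia) jb
      (≤-trans (+-monoˡ-≤ (toℕ i) 2≤m) (regular⇒arc-length reg arc)))

  reducedArcs-noncrossing : ∀ {a b c d} → Noncrossing P → ReducedArc P a b → ReducedArc P c d →
                            toℕ a < toℕ c → toℕ c ≤ toℕ b → toℕ b < toℕ d → ⊥
  reducedArcs-noncrossing nc (i , j , arc , ia , jb) (i′ , j′ , arc′ , i′c , j′d) a<c c≤b b<d =
    arcs-noncrossing nc arc arc′
      (subst₂ _<_ (sym ia) (sym i′c) a<c)
      (subst₂ _≤_ (cong suc (sym i′c)) (sym jb) (s≤s c≤b))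
      (subst₂ _<_ (sym jb) (sym j′d) (s≤s b<d))

  reducedArcs-nonconsecutive : ∀ {m a b c} → 2 ≤ m → Regular m P → Noncrossing P →
                               ReducedArc P a b → ReducedArc P b c → ⊥
  reducedArcs-nonconsecutive 2≤m reg nc ab bc =
    reducedArcs-noncrossing nc ab bc (reducedArc-increasing 2≤m reg ab) ≤-refl
      (reducedArc-increasing 2≤m reg bc)

  Adjacent : Fin n′ → Fin n′ → Set
  Adjacent = ReflClosure (SymClosure (ReducedArc P))

  module _ {m : ℕ} (2≤m : 2 ≤ m) (reg : Regular m P) (nc : Noncrossing P) where

    step-adjacent⇒adjacent : ∀ {x y z} → SymClosure (ReducedArc P) x y → Adjacent y z → Adjacent x z
    step-adjacent⇒adjacent xy       refl       = [ xy ]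
    step-adjacent⇒adjacent (fwd xy) [ fwd yz ] = ⊥-elim (reducedArcs-nonconsecutive 2≤m reg nc xy yz)
    step-adjacent⇒adjacent (bwd yx) [ bwd zy ] = ⊥-elim (reducedArcs-nonconsecutive 2≤m reg nc zy yx)
    step-adjacent⇒adjacent (fwd xy) [ bwd zy ] rewrite reducedArc-source-unique xy zy = refl
    step-adjacent⇒adjacent (bwd yx) [ fwd yz ] rewrite reducedArc-target-unique yx yz = refl

    rBlock⇒adjacent : ∀ {x y} → RBlock P x y → Adjacent x y
    rBlock⇒adjacent ε         = refl
    rBlock⇒adjacent (xy ◅ yz) = step-adjacent⇒adjacent xy (rBlock⇒adjacent yz)

    rBlock⇒reducedArc : ∀ {x y} → toℕ x < toℕ y → RBlock P x y → ReducedArc P x y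
    rBlock⇒reducedArc x<y x~y with rBlock⇒adjacent x~y
    ... | refl       = ⊥-elim (<-irrefl refl x<y)
    ... | [ fwd xy ] = xy
    ... | [ bwd yx ] = ⊥-elim (<-asym x<y (reducedArc-increasing 2≤m reg yx))

mainTheorem2 : (n' k m : ℕ) → 1 ≤ k → 2 ≤ m →
    (P : Fin (suc n') → Fin k) → Surj P → Regular m P → Noncrossing P →
    NoncrossingRel (RBlock P)
mainTheorem2 n' k m _ 2≤m P _ reg nc x u y v x<u u<y y<v (x~y , u~v , _) =
  reducedArcs-noncrossing nc (rBlock⇒reducedArc 2≤m reg nc (<-trans x<u u<y) x~y)
                             (rBlock⇒reducedArc 2≤m reg nc (<-trans u<y y<v) u~v)
                             x<u (<⇒≤ u<y) y<v
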